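{- Let $k\ge 2$ and $A=\{1,\dots,k\}$. Any normed $k$-tree (a tree with vertex set $\{1,\dots,k\}$ in which vertex $1$ has order $1$, viewed as an oriented $(k-2)$-dimensional cycle of $K_k$) is homologous in $K_k$ to an integer linear combination of normed linear $k$-trees, i.e., of normed $k$-trees all of whose vertices have order at most $2$.
   Context: $\Delta_k$ is the simplex whose vertices correspond to the two-element subsets of $\{1,\dots,k\}$; a face is identified with the graph on vertex set $\{1,\dots,k\}$ whose edges are the corresponding subsets. A graph is connected if any two vertices are joined by a chain of its edges. $M_k$ is the subcomplex of faces with non-connected graphs, and $K_k=\Delta_k/M_k$ is the quotient simplicial chain complex (integer coefficients). A tree on $k$ vertices has $k-1$ edges, so it is a $(k-2)$-dimensional face all of whose boundary faces are non-connected; hence (once oriented) it is a cycle of $K_k$. -}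

module Defs where

open import Data.Nat as ℕ using (ℕ; zero; suc; _≤_; _∸_)
open import Data.Fin as Fin using (Fin; toℕ; inject₁; fromℕ; _<?_)
open import Data.Fin.Subset using (Subset; _∈_; _∩_; _∪_; ⁅_⁆; ∣_∣)
open import Data.Integer as ℤ using (ℤ; +_; -_)
open import Data.Bool using (Bool; true; false; if_then_else_; _∨_)
open import Data.List as List using (List; allFin; concatMap; map; filter; length)
open import Data.Vec as Vec using (tabulate)
open import Data.Vec.Properties using (≡-dec)
open import Data.Bool.Properties using () renaming (_≟_ to _≟ᵇ_)
open import Data.Product using (Σ; _×_; _,_; ∃; proj₁; proj₂)
open import Data.Sum using (_⊎_)
open import Function.Definitions using (Injective)
open import Relation.Nullary using (Dec; yes; no; ¬_)
open import Relation.Nullary.Decidable using (⌊_⌋)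
open import Relation.Binary.PropositionalEquality using (_≡_)

-- Vertices of the graphs are Fin k (vertex "1" of the paper is Fin.zero).
-- Vertices of the simplex Δ_k: the two-element subsets {i,j} of Fin k,
-- listed as pairs (i , j) with i < j, in lexicographic order.
edgeList : (k : ℕ) → List (Fin k × Fin k)
edgeList k = concatMap (λ i → map (λ j → (i , j)) (filter (λ j → i <? j) (allFin k))) (allFin k)

nE : ℕ → ℕ
nE k = length (edgeList k)

ends : (k : ℕ) → Fin (nE k) → Fin k × Fin k
ends k e = List.lookup (edgeList k) e

-- A face of Δ_k (= a graph on Fin k) is a subset of the edges.
Graph : ℕ → Set
Graph k = Subset (nE k)

Adj : (k : ℕ) → Graph k → Fin k → Fin k → Set
Adj k σ a b = Σ (Fin (nE k)) λ e → e ∈ σ × (ends k e ≡ (a , b) ⊎ ends k e ≡ (b , a))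

data Reach (k : ℕ) (σ : Graph k) (i : Fin k) : Fin k → Set where
  here : Reach k σ i i
  step : ∀ {j l} → Reach k σ i j → Adj k σ j l → Reach k σ i l

Connected : (k : ℕ) → Graph k → Set
Connected k σ = ∀ i j → Reach k σ i j

record Cycle (k : ℕ) (σ : Graph k) : Set where
  field
    m     : ℕ
    v     : Fin (suc (suc (suc m))) → Fin k
    inj   : Injective _≡_ _≡_ v
    adj   : ∀ (i : Fin (suc (suc m))) → Adj k σ (v (inject₁ i)) (v (Fin.suc i))
    close : Adj k σ (v (fromℕ (suc (suc m)))) (v Fin.zero)

Acyclic : (k : ℕ) → Graph k → Set
Acyclic k σ = ¬ Cycle k σ

Tree : (k : ℕ) → Graph k → Set
Tree k σ = Connected k σ × Acyclic k σ

incident : (k : ℕ) → Fin k → Subset (nE k)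
incident k v = tabulate λ e → ⌊ Fin._≟_ (proj₁ (ends k e)) v ⌋ ∨ ⌊ Fin._≟_ (proj₂ (ends k e)) v ⌋

order : (k : ℕ) → Graph k → Fin k → ℕ
order k σ v = ∣ σ ∩ incident k v ∣

NormedTree : (k : ℕ) → Graph k → Set
NormedTree k σ = Tree k σ × (∀ v → toℕ v ≡ 0 → order k σ v ≡ 1)

NormedLinearTree : (k : ℕ) → Graph k → Set
NormedLinearTree k σ = NormedTree k σ × (∀ v → order k σ v ≤ 2)

-- The chain complex K_k = Δ_k / M_k.
-- Faces are oriented by the fixed order of edge indices; a chain is a
-- function Graph k → ℤ (coefficient of each ascending-oriented face).
-- In K_k only the coefficients on connected faces matter.

sumFin : (n : ℕ) → (Fin n → ℤ) → ℤ
sumFin zero    f = + 0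
sumFin (suc n) f = f Fin.zero ℤ.+ sumFin n (λ i → f (Fin.suc i))

sgn : ℕ → ℤ
sgn zero          = + 1
sgn (suc zero)    = - (+ 1)
sgn (suc (suc n)) = sgn n

below : (k : ℕ) → Fin (nE k) → Subset (nE k)
below k e = tabulate λ e' → ⌊ e' <? e ⌋

-- coefficient of face σ in the simplicial boundary of the chain c:
-- the face σ ∪ {e} (e ∉ σ) has e in position |{e' ∈ σ | e' < e}|.
∂ : (k : ℕ) → (Graph k → ℤ) → Graph k → ℤ
∂ k c σ = sumFin (nE k) λ e → if Vec.lookup σ e then + 0
            else sgn ∣ σ ∩ below k e ∣ ℤ.* c (σ ∪ ⁅ e ⁆)

elem : (k : ℕ) → Graph k → Graph k → ℤ
elem k T σ = if ⌊ ≡-dec _≟ᵇ_ T σ ⌋ then + 1 else + 0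

-- Grow a path 0 = v₀, v₁, …, vₗ in T keeping v₀ a leaf and v₁, …, vₗ₋₁ of order 2. If vₗ is a
-- leaf, T is a normed linear tree; if vₗ has exactly one edge off the path, the path grows.
-- Otherwise take two such edges vₗc₁, vₗc₂ and close the triangle with the edge c₁c₂ to get U.
-- A connected graph with k − 1 edges has no triangle, so among the faces of U only T, U − vₗc₁
-- and U − vₗc₂ are connected, and ∂U relates T to these two trees. Both still contain the path,
-- with vₗ of smaller order, so induction on (k − l, order of vₗ) concludes.
module Submission where

open import Defs
open import Data.Bool using (Bool; true; false; _∧_; _∨_; if_then_else_)
import Data.Bool.Properties as 𝔹
open import Data.Empty using (⊥; ⊥-elim)
open import Data.Fin as Fin using (Fin; toℕ; _<?_)
import Data.Fin.Properties as Fin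
open import Data.Fin.Subset using (Subset; _∈_; _∩_; _∪_; ⁅_⁆; ∣_∣)
import Data.Fin.Subset.Properties as Subset
open import Data.Integer using (ℤ; +_; -_; _+_; _*_; _-_)
import Data.Integer.Properties as ℤ
open import Data.Integer.Tactic.RingSolver using (solve-∀)
open import Data.List as List using (List; _∷_; allFin; map; filter)
import Data.List.Membership.Propositional as List
import Data.List.Membership.Propositional.Properties as List
import Data.List.Relation.Unary.All as All
import Data.List.Relation.Unary.All.Properties as All
open import Data.List.Relation.Unary.AllPairs as AllPairs using (_∷_)
import Data.List.Relation.Unary.AllPairs.Properties as AllPairs
import Data.List.Relation.Unary.Any as Any
import Data.List.Relation.Unary.Any.Properties as Any
open import Data.List.Relation.Unary.Unique.Propositional using (Unique)
import Data.List.Relation.Unary.Unique.Propositional.Properties as Unique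
open import Data.Nat as ℕ using (ℕ; zero; suc; _≤_; _<_; _∸_; z≤n; s≤s)
open import Data.Nat.Induction using (<-rec)
import Data.Nat.Properties as ℕ
open import Data.Product using (Σ; _×_; _,_; proj₁; proj₂)
open import Data.Sum using (_⊎_; inj₁; inj₂; map₁)
open import Data.Vec as Vec using (Vec; []; _∷_; lookup; tabulate; _[_]≔_)
import Data.Vec.Properties as Vec
open import Function using (_∘_)
open import Function.Definitions using (Injective)
open import Relation.Binary.Definitions using (tri<; tri≈; tri>)
open import Relation.Binary.PropositionalEquality
open import Relation.Nullary using (¬_; yes; no)
open import Relation.Nullary.Decidable using (⌊_⌋)

private
  variable
    n : ℕ

lookup-injective : ∀ {A : Set} {xs : List A} → Unique xs → Injective _≡_ _≡_ (List.lookup xs)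
lookup-injective {xs = _ ∷ _} _ {Fin.zero} {Fin.zero} _ = refl
lookup-injective {xs = _ ∷ _} (x∉ ∷ _) {Fin.zero} {Fin.suc j} eq = ⊥-elim (All.lookup x∉ (List.∈-lookup j) eq)
lookup-injective {xs = _ ∷ _} (x∉ ∷ _) {Fin.suc i} {Fin.zero} eq = ⊥-elim (All.lookup x∉ (List.∈-lookup i) (sym eq))
lookup-injective {xs = _ ∷ _} (_ ∷ u) {Fin.suc i} {Fin.suc j} eq = cong Fin.suc (lookup-injective u eq)

private
  edgeRow : (k : ℕ) → Fin k → List (Fin k × Fin k)
  edgeRow k i = map (i ,_) (filter (i <?_) (allFin k))

∈edgeList⇒< : ∀ {k} {i j : Fin k} → (i , j) List.∈ edgeList k → i Fin.< j
∈edgeList⇒< {k} m with Any.satisfied (List.∈-concatMap⁻ (edgeRow k) {xs = allFin k} m)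
... | i , m′ with List.∈-map⁻ (i ,_) m′
... | j , j∈ , refl = proj₂ (List.∈-filter⁻ (i <?_) {xs = allFin k} j∈)

<⇒∈edgeList : ∀ {k} {i j : Fin k} → i Fin.< j → (i , j) List.∈ edgeList k
<⇒∈edgeList {k} {i} i<j = List.∈-concatMap⁺ (edgeRow k) {xs = allFin k}
  (Any.map (λ { refl → List.∈-map⁺ (i ,_) (List.∈-filter⁺ (i <?_) (List.∈-allFin _) i<j) }) (List.∈-allFin i))

edgeList-unique : ∀ k → Unique (edgeList k)
edgeList-unique k = Unique.concat⁺
  (All.map⁺ (All.tabulate λ {i} _ → Unique.map⁺ (cong proj₂) (Unique.filter⁺ (i <?_) (Unique.allFin⁺ k))))
  (AllPairs.map⁺ (AllPairs.map rows-disjoint (Unique.allFin⁺ k)))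
  where
  rows-disjoint : ∀ {i i′} → i ≢ i′ → ∀ {v} → ¬ (v List.∈ edgeRow k i × v List.∈ edgeRow k i′)
  rows-disjoint {i} {i′} i≢i′ (m , m′) with List.∈-map⁻ (i ,_) m | List.∈-map⁻ (i′ ,_) m′
  ... | _ , _ , refl | _ , _ , eq = i≢i′ (cong proj₁ eq)

ends-< : ∀ k e → proj₁ (ends k e) Fin.< proj₂ (ends k e)
ends-< k e = ∈edgeList⇒< (List.∈-lookup e)

ends-injective : ∀ k → Injective _≡_ _≡_ (ends k)
ends-injective k = lookup-injective (edgeList-unique k)

edgeWithEnds : ∀ {k} {i j : Fin k} → i Fin.< j → Σ (Fin (nE k)) λ e → ends k e ≡ (i , j)
edgeWithEnds i<j = Any.index m , sym (Any.lookup-index m)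
  where m = <⇒∈edgeList i<j

lookup-ext : ∀ {A : Set} (xs ys : Vec A n) → (∀ i → lookup xs i ≡ lookup ys i) → xs ≡ ys
lookup-ext xs ys eq = trans (sym (Vec.tabulate∘lookup xs)) (trans (Vec.tabulate-cong eq) (Vec.tabulate∘lookup ys))

-- Subsets are handled through lookup p x ≡ true, the form in which the Boolean formulas of Defs compute.
_⊆ᵇ_ : Subset n → Subset n → Set
p ⊆ᵇ q = ∀ i → lookup p i ≡ true → lookup q i ≡ true

true≢false : true ≢ false
true≢false ()

∣p∣≡1+∣p-x∣ : ∀ (p : Subset n) x → lookup p x ≡ true → ∣ p ∣ ≡ suc ∣ p [ x ]≔ false ∣
∣p∣≡1+∣p-x∣ (true ∷ p) Fin.zero _ = refl
∣p∣≡1+∣p-x∣ (true ∷ p) (Fin.suc x) x∈p = cong suc (∣p∣≡1+∣p-x∣ p x x∈p)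
∣p∣≡1+∣p-x∣ (false ∷ p) (Fin.suc x) x∈p = ∣p∣≡1+∣p-x∣ p x x∈p

∣p+x∣≡1+∣p∣ : ∀ (p : Subset n) x → lookup p x ≡ false → ∣ p [ x ]≔ true ∣ ≡ suc ∣ p ∣
∣p+x∣≡1+∣p∣ (false ∷ p) Fin.zero _ = refl
∣p+x∣≡1+∣p∣ (true ∷ p) (Fin.suc x) x∉p = cong suc (∣p+x∣≡1+∣p∣ p x x∉p)
∣p+x∣≡1+∣p∣ (false ∷ p) (Fin.suc x) x∉p = ∣p+x∣≡1+∣p∣ p x x∉p

⊆ᵇ⇒∣p∣≤∣q∣ : ∀ (p q : Subset n) → p ⊆ᵇ q → ∣ p ∣ ≤ ∣ q ∣
⊆ᵇ⇒∣p∣≤∣q∣ [] [] _ = z≤n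
⊆ᵇ⇒∣p∣≤∣q∣ (true ∷ p) (true ∷ q) p⊆q = s≤s (⊆ᵇ⇒∣p∣≤∣q∣ p q λ i → p⊆q (Fin.suc i))
⊆ᵇ⇒∣p∣≤∣q∣ (true ∷ p) (false ∷ q) p⊆q with () ← p⊆q Fin.zero refl
⊆ᵇ⇒∣p∣≤∣q∣ (false ∷ p) (true ∷ q) p⊆q = ℕ.m≤n⇒m≤1+n (⊆ᵇ⇒∣p∣≤∣q∣ p q λ i → p⊆q (Fin.suc i))
⊆ᵇ⇒∣p∣≤∣q∣ (false ∷ p) (false ∷ q) p⊆q = ⊆ᵇ⇒∣p∣≤∣q∣ p q λ i → p⊆q (Fin.suc i)

⊂ᵇ⇒∣p∣<∣q∣ : ∀ (p q : Subset n) → p ⊆ᵇ q → ∀ x → lookup p x ≡ false → lookup q x ≡ true → ∣ p ∣ < ∣ q ∣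
⊂ᵇ⇒∣p∣<∣q∣ (false ∷ p) (true ∷ q) p⊆q Fin.zero _ _ = s≤s (⊆ᵇ⇒∣p∣≤∣q∣ p q λ i → p⊆q (Fin.suc i))
⊂ᵇ⇒∣p∣<∣q∣ (true ∷ p) (true ∷ q) p⊆q (Fin.suc x) x∉p x∈q = s≤s (⊂ᵇ⇒∣p∣<∣q∣ p q (λ i → p⊆q (Fin.suc i)) x x∉p x∈q)
⊂ᵇ⇒∣p∣<∣q∣ (true ∷ p) (false ∷ q) p⊆q (Fin.suc x) _ _ with () ← p⊆q Fin.zero refl
⊂ᵇ⇒∣p∣<∣q∣ (false ∷ p) (true ∷ q) p⊆q (Fin.suc x) x∉p x∈q = ℕ.m≤n⇒m≤1+n (⊂ᵇ⇒∣p∣<∣q∣ p q (λ i → p⊆q (Fin.suc i)) x x∉p x∈q)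
⊂ᵇ⇒∣p∣<∣q∣ (false ∷ p) (false ∷ q) p⊆q (Fin.suc x) x∉p x∈q = ⊂ᵇ⇒∣p∣<∣q∣ p q (λ i → p⊆q (Fin.suc i)) x x∉p x∈q

∣p∣>0⇒member : ∀ (p : Subset n) → 0 < ∣ p ∣ → Σ (Fin n) λ x → lookup p x ≡ true
∣p∣>0⇒member (true ∷ p) _ = Fin.zero , refl
∣p∣>0⇒member (false ∷ p) ∣p∣>0 with x , x∈p ← ∣p∣>0⇒member p ∣p∣>0 = Fin.suc x , x∈p

∣p∣<n⇒nonmember : ∀ (p : Subset n) → ∣ p ∣ < n → Σ (Fin n) λ x → lookup p x ≡ false
∣p∣<n⇒nonmember (true ∷ p) (s≤s ∣p∣<n) with x , x∉p ← ∣p∣<n⇒nonmember p ∣p∣<n = Fin.suc x , x∉p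
∣p∣<n⇒nonmember (false ∷ p) _ = Fin.zero , refl

lookup-p-x : ∀ (p : Subset n) {x y} → y ≢ x → lookup (p [ x ]≔ false) y ≡ lookup p y
lookup-p-x p y≢x = Vec.lookup∘update′ y≢x p false

member≢ : ∀ (p : Subset n) {x} → lookup p x ≡ true → 2 ≤ ∣ p ∣ → Σ (Fin n) λ y → lookup p y ≡ true × y ≢ x
member≢ p {x} x∈p 2≤∣p∣ with ∣p∣>0⇒member (p [ x ]≔ false) (ℕ.≤-pred (subst (2 ≤_) (∣p∣≡1+∣p-x∣ p x x∈p) 2≤∣p∣))
... | y , y∈p-x with y Fin.≟ x
...   | yes refl = ⊥-elim (true≢false (trans (sym y∈p-x) (Vec.lookup∘update x p false)))
...   | no y≢x = y , trans (sym (lookup-p-x p y≢x)) y∈p-x , y≢x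

member≢≢ : ∀ (p : Subset n) {x y} → lookup p x ≡ true → lookup p y ≡ true → y ≢ x → 3 ≤ ∣ p ∣ →
           Σ (Fin n) λ z → lookup p z ≡ true × z ≢ x × z ≢ y
member≢≢ p {x} x∈p y∈p y≢x 3≤∣p∣ with member≢ (p [ x ]≔ false) (trans (lookup-p-x p y≢x) y∈p)
                                          (ℕ.≤-pred (subst (3 ≤_) (∣p∣≡1+∣p-x∣ p x x∈p) 3≤∣p∣))
... | z , z∈p-x , z≢y with z Fin.≟ x
...   | yes refl = ⊥-elim (true≢false (trans (sym z∈p-x) (Vec.lookup∘update x p false)))
...   | no z≢x = z , trans (sym (lookup-p-x p z≢x)) z∈p-x , z≢x , z≢y

∣p∣≥1 : ∀ (p : Subset n) {x} → lookup p x ≡ true → 1 ≤ ∣ p ∣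
∣p∣≥1 p {x} x∈p = subst (1 ≤_) (sym (∣p∣≡1+∣p-x∣ p x x∈p)) (s≤s z≤n)

∣p∣≥2 : ∀ (p : Subset n) {x y} → lookup p x ≡ true → lookup p y ≡ true → y ≢ x → 2 ≤ ∣ p ∣
∣p∣≥2 p {x} x∈p y∈p y≢x =
  subst (2 ≤_) (sym (∣p∣≡1+∣p-x∣ p x x∈p)) (s≤s (∣p∣≥1 (p [ x ]≔ false) (trans (lookup-p-x p y≢x) y∈p)))

∣p∣≥3 : ∀ (p : Subset n) {x y z} → lookup p x ≡ true → lookup p y ≡ true → lookup p z ≡ true →
        y ≢ x → z ≢ x → z ≢ y → 3 ≤ ∣ p ∣
∣p∣≥3 p {x} x∈p y∈p z∈p y≢x z≢x z≢y =
  subst (3 ≤_) (sym (∣p∣≡1+∣p-x∣ p x x∈p))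
    (s≤s (∣p∣≥2 (p [ x ]≔ false) (trans (lookup-p-x p y≢x) y∈p) (trans (lookup-p-x p z≢x) z∈p) z≢y))

Joins : (k : ℕ) → Fin (nE k) → Fin k → Fin k → Set
Joins k e a b = ends k e ≡ (a , b) ⊎ ends k e ≡ (b , a)

module _ {k : ℕ} where

  joins-sym : ∀ {e a b} → Joins k e a b → Joins k e b a
  joins-sym (inj₁ eq) = inj₂ eq
  joins-sym (inj₂ eq) = inj₁ eq

  private
    <-of-ends : ∀ {e a b} → ends k e ≡ (a , b) → a Fin.< b
    <-of-ends {e} refl = ends-< k e

    ,-injective : ∀ {a b c d : Fin k} → (a , b) ≡ (c , d) → a ≡ c × b ≡ d
    ,-injective refl = refl , refl

  joins-irrefl : ∀ {e a b} → Joins k e a b → a ≢ b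
  joins-irrefl (inj₁ eq) refl = Fin.<-irrefl refl (<-of-ends eq)
  joins-irrefl (inj₂ eq) refl = Fin.<-irrefl refl (<-of-ends eq)

  joins-unique : ∀ {e e′ a b} → Joins k e a b → Joins k e′ a b → e ≡ e′
  joins-unique (inj₁ eq) (inj₁ eq′) = ends-injective k (trans eq (sym eq′))
  joins-unique (inj₁ eq) (inj₂ eq′) = ⊥-elim (Fin.<-asym (<-of-ends eq) (<-of-ends eq′))
  joins-unique (inj₂ eq) (inj₁ eq′) = ⊥-elim (Fin.<-asym (<-of-ends eq) (<-of-ends eq′))
  joins-unique (inj₂ eq) (inj₂ eq′) = ends-injective k (trans eq (sym eq′))

  joins-ends : ∀ {e a b c d} → Joins k e a b → Joins k e c d → (a ≡ c × b ≡ d) ⊎ (a ≡ d × b ≡ c)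
  joins-ends (inj₁ eq) (inj₁ eq′) = inj₁ (,-injective (trans (sym eq) eq′))
  joins-ends (inj₁ eq) (inj₂ eq′) = inj₂ (,-injective (trans (sym eq) eq′))
  joins-ends (inj₂ eq) (inj₁ eq′) = let a≡d , b≡c = ,-injective (trans (sym eq) eq′) in inj₂ (b≡c , a≡d)
  joins-ends (inj₂ eq) (inj₂ eq′) = let b≡d , a≡c = ,-injective (trans (sym eq) eq′) in inj₁ (a≡c , b≡d)

  joins-≢ : ∀ {e e′ v x y} → Joins k e v x → Joins k e′ v y → x ≢ y → e ≢ e′
  joins-≢ j j′ x≢y refl with joins-ends j j′
  ... | inj₁ (_ , x≡y) = x≢y x≡y
  ... | inj₂ (_ , x≡v) = joins-irrefl j (sym x≡v)

  edgeJoining : ∀ {a b : Fin k} → a ≢ b → Σ (Fin (nE k)) λ e → Joins k e a b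
  edgeJoining {a} {b} a≢b with Fin.<-cmp a b
  ... | tri< a<b _ _ = let e , eq = edgeWithEnds a<b in e , inj₁ eq
  ... | tri≈ _ a≡b _ = ⊥-elim (a≢b a≡b)
  ... | tri> _ _ b<a = let e , eq = edgeWithEnds b<a in e , inj₂ eq

  private
    touches : Fin k → Fin k × Fin k → Bool
    touches v (a , b) = ⌊ a Fin.≟ v ⌋ ∨ ⌊ b Fin.≟ v ⌋

    lookup-incident : ∀ v e → lookup (incident k v) e ≡ touches v (ends k e)
    lookup-incident v e = Vec.lookup∘tabulate _ e

    touches-joins : ∀ {v x p} → p ≡ (v , x) ⊎ p ≡ (x , v) → touches v p ≡ true
    touches-joins {v} (inj₁ refl) with v Fin.≟ v
    ... | yes _ = refl
    ... | no v≢v = ⊥-elim (v≢v refl)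
    touches-joins {v} {x} (inj₂ refl) with v Fin.≟ v
    ... | yes _ = 𝔹.∨-zeroʳ _
    ... | no v≢v = ⊥-elim (v≢v refl)

    touches-¬joins : ∀ {v a b p} → p ≡ (a , b) ⊎ p ≡ (b , a) → v ≢ a → v ≢ b → touches v p ≡ false
    touches-¬joins {v} {a} {b} (inj₁ refl) v≢a v≢b with a Fin.≟ v | b Fin.≟ v
    ... | yes a≡v | _ = ⊥-elim (v≢a (sym a≡v))
    ... | no _ | yes b≡v = ⊥-elim (v≢b (sym b≡v))
    ... | no _ | no _ = refl
    touches-¬joins {v} {a} {b} (inj₂ refl) v≢a v≢b with b Fin.≟ v | a Fin.≟ v
    ... | yes b≡v | _ = ⊥-elim (v≢b (sym b≡v))
    ... | no _ | yes a≡v = ⊥-elim (v≢a (sym a≡v))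
    ... | no _ | no _ = refl

    touches⇒joins : ∀ {v} p → touches v p ≡ true → Σ (Fin k) λ x → p ≡ (v , x) ⊎ p ≡ (x , v)
    touches⇒joins {v} (a , b) t with a Fin.≟ v | b Fin.≟ v
    ... | yes refl | _ = b , inj₁ refl
    ... | no _ | yes refl = a , inj₂ refl

  incident-joins : ∀ {e v x} → Joins k e v x → lookup (incident k v) e ≡ true
  incident-joins {e} {v} j = trans (lookup-incident v e) (touches-joins j)

  incident-¬joins : ∀ {e a b v} → Joins k e a b → v ≢ a → v ≢ b → lookup (incident k v) e ≡ false
  incident-¬joins {e} {v = v} j v≢a v≢b = trans (lookup-incident v e) (touches-¬joins j v≢a v≢b)

  incident⇒joins : ∀ {e v} → lookup (incident k v) e ≡ true → Σ (Fin k) λ x → Joins k e v x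
  incident⇒joins {e} {v} e∈ = touches⇒joins (ends k e) (trans (sym (lookup-incident v e)) e∈)

lookup-∩ : ∀ (p q : Subset n) i → lookup (p ∩ q) i ≡ lookup p i ∧ lookup q i
lookup-∩ p q i = Vec.lookup-zipWith _∧_ i p q

lookup-∪ : ∀ (p q : Subset n) i → lookup (p ∪ q) i ≡ lookup p i ∨ lookup q i
lookup-∪ p q i = Vec.lookup-zipWith _∨_ i p q

module _ {k : ℕ} {G : Graph k} where

  adj-sym : ∀ {a b} → Adj k G a b → Adj k G b a
  adj-sym (e , e∈G , j) = e , e∈G , joins-sym j

  adj⇒reach : ∀ {a b} → Adj k G a b → Reach k G a b
  adj⇒reach = step here

  reach-trans : ∀ {a b c} → Reach k G a b → Reach k G b c → Reach k G a c
  reach-trans r here = r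
  reach-trans r (step s ab) = step (reach-trans r s) ab

  reach-sym : ∀ {a b} → Reach k G a b → Reach k G b a
  reach-sym here = here
  reach-sym (step r ab) = reach-trans (adj⇒reach (adj-sym ab)) (reach-sym r)

  first-edge : ∀ {a b} → Reach k G a b → a ≢ b → Σ (Fin k) (Adj k G a)
  first-edge here a≢a = ⊥-elim (a≢a refl)
  first-edge {a} (step {j = c} r cb) a≢b with a Fin.≟ c
  ... | yes refl = _ , cb
  ... | no a≢c = first-edge r a≢c

  ∈incidence : ∀ {e v x} → lookup G e ≡ true → Joins k e v x → lookup (G ∩ incident k v) e ≡ true
  ∈incidence {e} {v} e∈G j rewrite lookup-∩ G (incident k v) e | e∈G = incident-joins j

  ∈incidence⁻ : ∀ {e v} → lookup (G ∩ incident k v) e ≡ true → lookup G e ≡ true × Σ (Fin k) (Joins k e v)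
  ∈incidence⁻ {e} {v} e∈ rewrite lookup-∩ G (incident k v) e =
    𝔹.∧-conicalˡ _ _ e∈ , incident⇒joins (𝔹.∧-conicalʳ (lookup G e) _ e∈)

  order-≥2 : ∀ {e e′ v x y} → lookup G e ≡ true → Joins k e v x → lookup G e′ ≡ true → Joins k e′ v y →
             x ≢ y → 2 ≤ order k G v
  order-≥2 {v = v} e∈G j e′∈G j′ x≢y =
    ∣p∣≥2 (G ∩ incident k v) (∈incidence e∈G j) (∈incidence e′∈G j′) (joins-≢ j′ j (x≢y ∘ sym))

  order-≥3 : ∀ {e e′ e″ v x y z} → lookup G e ≡ true → Joins k e v x → lookup G e′ ≡ true → Joins k e′ v y →
             lookup G e″ ≡ true → Joins k e″ v z → x ≢ y → x ≢ z → y ≢ z → 3 ≤ order k G v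
  order-≥3 {v = v} e∈G j e′∈G j′ e″∈G j″ x≢y x≢z y≢z =
    ∣p∣≥3 (G ∩ incident k v) (∈incidence e∈G j) (∈incidence e′∈G j′) (∈incidence e″∈G j″)
      (joins-≢ j′ j (x≢y ∘ sym)) (joins-≢ j″ j (x≢z ∘ sym)) (joins-≢ j″ j′ (y≢z ∘ sym))

order-cong : ∀ {k} (G H : Graph k) v → (∀ e → lookup (incident k v) e ≡ true → lookup G e ≡ lookup H e) →
             order k G v ≡ order k H v
order-cong {k} G H v agree = cong ∣_∣ (lookup-ext (G ∩ incident k v) (H ∩ incident k v) pointwise)
  where
  pointwise : ∀ e → lookup (G ∩ incident k v) e ≡ lookup (H ∩ incident k v) e
  pointwise e rewrite lookup-∩ G (incident k v) e | lookup-∩ H (incident k v) e with lookup (incident k v) e in e∈v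
  ... | true rewrite agree e e∈v = refl
  ... | false = trans (𝔹.∧-zeroʳ _) (sym (𝔹.∧-zeroʳ _))

inner : (k : ℕ) → Subset k → Subset (nE k)
inner k S = tabulate λ e → lookup S (proj₁ (ends k e)) ∧ lookup S (proj₂ (ends k e))

module _ {k : ℕ} where

  lookup-inner : ∀ S e → lookup (inner k S) e ≡ lookup S (proj₁ (ends k e)) ∧ lookup S (proj₂ (ends k e))
  lookup-inner S e = Vec.lookup∘tabulate _ e

  joins-inner : ∀ S {e a b} → Joins k e a b → lookup S a ≡ true → lookup S b ≡ true → lookup (inner k S) e ≡ true
  joins-inner S {e} (inj₁ eq) a∈S b∈S rewrite lookup-inner S e | eq | a∈S | b∈S = refl
  joins-inner S {e} (inj₂ eq) a∈S b∈S rewrite lookup-inner S e | eq | a∈S | b∈S = refl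

  joins-outer : ∀ S {e a b} → Joins k e a b → lookup S b ≡ false → lookup (inner k S) e ≡ false
  joins-outer S {e} {a} (inj₁ eq) b∉S rewrite lookup-inner S e | eq | b∉S = 𝔹.∧-zeroʳ _
  joins-outer S {e} (inj₂ eq) b∉S rewrite lookup-inner S e | eq | b∉S = refl

  inner-mono : ∀ (G : Graph k) S S′ → S ⊆ᵇ S′ → (G ∩ inner k S) ⊆ᵇ (G ∩ inner k S′)
  inner-mono G S S′ S⊆S′ e e∈ rewrite lookup-∩ G (inner k S) e | lookup-∩ G (inner k S′) e
                                    | lookup-inner S e | lookup-inner S′ e
    with lookup G e | lookup S (proj₁ (ends k e)) in a∈S | lookup S (proj₂ (ends k e)) in b∈S
  ... | true | true | true rewrite S⊆S′ _ a∈S | S⊆S′ _ b∈S = refl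

  crossing : ∀ {G : Graph k} S {i j} → lookup S i ≡ true → lookup S j ≡ false → Reach k G i j →
             Σ (Fin k) λ a → Σ (Fin k) λ b → lookup S a ≡ true × lookup S b ≡ false × Adj k G a b
  crossing S i∈S i∉S here = ⊥-elim (true≢false (trans (sym i∈S) i∉S))
  crossing S {j = b} i∈S b∉S (step {j = a} r ab) with lookup S a in a∈S
  ... | true = a , b , a∈S , b∉S , ab
  ... | false = crossing S i∈S a∈S r

module _ {K : ℕ} (G : Graph (suc K)) (conn : Connected (suc K) G) where

  -- Grow a set S of vertices from one vertex, adding a neighbour at each step: each new
  -- vertex brings a new edge inside S.
  private
    k = suc K

    grow : ∀ m → m < k → Σ (Subset k) λ S → lookup S Fin.zero ≡ true × ∣ S ∣ ≡ suc m × m ≤ ∣ G ∩ inner k S ∣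
    grow zero _ = ⁅ Fin.zero ⁆ , refl , Subset.∣⁅x⁆∣≡1 {k} Fin.zero , z≤n
    grow (suc m) m<k with grow m (ℕ.<⇒≤ m<k)
    ... | S , 0∈S , ∣S∣≡ , m≤ with ∣p∣<n⇒nonmember S (subst (_< k) (sym ∣S∣≡) m<k)
    ... | x , x∉S with crossing S 0∈S x∉S (conn Fin.zero x)
    ... | a , b , a∈S , b∉S , (e , e∈G , j) =
      S′ , S⊆S′ _ 0∈S , trans (∣p+x∣≡1+∣p∣ S b b∉S) (cong suc ∣S∣≡) ,
      ℕ.≤-trans (s≤s m≤) (⊂ᵇ⇒∣p∣<∣q∣ (G ∩ inner k S) (G ∩ inner k S′) (inner-mono G S S′ S⊆S′) e e∉ e∈′)
      where
      S′ = S [ b ]≔ true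
      S⊆S′ : S ⊆ᵇ S′
      S⊆S′ i i∈S with i Fin.≟ b
      ... | yes refl = Vec.lookup∘update i S true
      ... | no i≢b = trans (Vec.lookup∘update′ i≢b S true) i∈S
      e∉ : lookup (G ∩ inner k S) e ≡ false
      e∉ rewrite lookup-∩ G (inner k S) e | joins-outer S j b∉S = 𝔹.∧-zeroʳ _
      e∈′ : lookup (G ∩ inner k S′) e ≡ true
      e∈′ rewrite lookup-∩ G (inner k S′) e | Vec.[]=⇒lookup e∈G =
        joins-inner S′ j (S⊆S′ a a∈S) (Vec.lookup∘update b S true)

  connected⇒size≥ : K ≤ ∣ G ∣
  connected⇒size≥ with S , _ , _ , K≤ ← grow K ℕ.≤-refl = ℕ.≤-trans K≤ (Subset.∣p∩q∣≤∣p∣ G (inner k S))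

module _ {k : ℕ} where

  connected-mono : ∀ {G H : Graph k} → (∀ {a b} → Adj k G a b → Reach k H a b) → Connected k G → Connected k H
  connected-mono {G} {H} G⇒H conn i j = mono (conn i j)
    where
    mono : ∀ {a b} → Reach k G a b → Reach k H a b
    mono here = here
    mono (step r ab) = reach-trans (mono r) (G⇒H ab)

  -- The other two edges of the triangle reconnect the ends of t₁.
  connected-minus-triangle-edge :
    ∀ {G : Graph k} {a b c t₁ t₂ t₃} → Connected k G →
    lookup G t₂ ≡ true → lookup G t₃ ≡ true → Joins k t₁ a b → Joins k t₂ b c → Joins k t₃ a c →
    Connected k (G [ t₁ ]≔ false)
  connected-minus-triangle-edge {G} {a} {b} {c} {t₁} {t₂} {t₃} conn t₂∈G t₃∈G j₁ j₂ j₃ = connected-mono reroute conn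
    where
    G′ = G [ t₁ ]≔ false
    keep : ∀ {t} → t ≢ t₁ → lookup G t ≡ true → t ∈ G′
    keep {t} t≢t₁ t∈G = Vec.lookup⇒[]= t G′ (trans (Vec.lookup∘update′ t≢t₁ G false) t∈G)
    t₂≢t₁ : t₂ ≢ t₁
    t₂≢t₁ refl with joins-ends j₁ j₂
    ... | inj₁ (a≡b , _) = joins-irrefl j₁ a≡b
    ... | inj₂ (a≡c , _) = joins-irrefl j₃ a≡c
    t₃≢t₁ : t₃ ≢ t₁
    t₃≢t₁ refl with joins-ends j₁ j₃
    ... | inj₁ (_ , b≡c) = joins-irrefl j₂ b≡c
    ... | inj₂ (_ , b≡a) = joins-irrefl j₁ (sym b≡a)
    a⇝b : Reach k G′ a b
    a⇝b = step (adj⇒reach (t₃ , keep t₃≢t₁ t₃∈G , j₃)) (t₂ , keep t₂≢t₁ t₂∈G , joins-sym j₂)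
    reroute : ∀ {x y} → Adj k G x y → Reach k G′ x y
    reroute (t , t∈G , j) with t Fin.≟ t₁
    ... | no t≢t₁ = adj⇒reach (t , keep t≢t₁ (Vec.[]=⇒lookup t∈G) , j)
    ... | yes refl with joins-ends j j₁
    ...   | inj₁ (refl , refl) = a⇝b
    ...   | inj₂ (refl , refl) = reach-sym a⇝b

-- Otherwise it would stay connected after losing an edge, with only k − 2 edges left.
connected-¬triangle :
  ∀ {k} {G : Graph k} {a b c t₁ t₂ t₃} → Connected k G → ∣ G ∣ ≡ k ∸ 1 →
  lookup G t₁ ≡ true → lookup G t₂ ≡ true → lookup G t₃ ≡ true →
  Joins k t₁ a b → Joins k t₂ b c → Joins k t₃ a c → ⊥
connected-¬triangle {zero} {a = ()}
connected-¬triangle {suc K} {G} {t₁ = t₁} conn ∣G∣≡ t₁∈G t₂∈G t₃∈G j₁ j₂ j₃ =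
  ℕ.<-irrefl refl (ℕ.≤-trans (s≤s (connected⇒size≥ _ (connected-minus-triangle-edge conn t₂∈G t₃∈G j₁ j₂ j₃)))
                             (ℕ.≤-reflexive (trans (sym (∣p∣≡1+∣p-x∣ G t₁ t₁∈G)) ∣G∣≡)))

sumFin-cong : ∀ n {f g : Fin n → ℤ} → (∀ i → f i ≡ g i) → sumFin n f ≡ sumFin n g
sumFin-cong zero _ = refl
sumFin-cong (suc n) f≗g = cong₂ _+_ (f≗g Fin.zero) (sumFin-cong n (f≗g ∘ Fin.suc))

sumFin-+ : ∀ n (f g : Fin n → ℤ) → sumFin n (λ i → f i + g i) ≡ sumFin n f + sumFin n g
sumFin-+ zero f g = refl
sumFin-+ (suc n) f g rewrite sumFin-+ n (f ∘ Fin.suc) (g ∘ Fin.suc) =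
  interchange (f Fin.zero) (g Fin.zero) (sumFin n (f ∘ Fin.suc)) (sumFin n (g ∘ Fin.suc))
  where
  interchange : ∀ a b c d → (a + b) + (c + d) ≡ (a + c) + (b + d)
  interchange = solve-∀

sumFin-* : ∀ n x (f : Fin n → ℤ) → sumFin n (λ i → x * f i) ≡ x * sumFin n f
sumFin-* zero x f = sym (ℤ.*-zeroʳ x)
sumFin-* (suc n) x f rewrite sumFin-* n x (f ∘ Fin.suc) = sym (ℤ.*-distribˡ-+ x _ _)

sumFin-point : ∀ n (t : Fin n) x → sumFin n (λ i → if ⌊ i Fin.≟ t ⌋ then x else + 0) ≡ x
sumFin-point (suc n) Fin.zero x = trans (cong (λ y → x + y) (sumFin-0 n)) (ℤ.+-identityʳ x)
  where
  sumFin-0 : ∀ n → sumFin n (λ _ → + 0) ≡ + 0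
  sumFin-0 zero = refl
  sumFin-0 (suc n) = trans (ℤ.+-identityˡ _) (sumFin-0 n)
sumFin-point (suc n) (Fin.suc t) x = trans (ℤ.+-identityˡ _) (trans (sumFin-cong n shift) (sumFin-point n t x))
  where
  shift : ∀ i → (if ⌊ Fin.suc i Fin.≟ Fin.suc t ⌋ then x else + 0) ≡ (if ⌊ i Fin.≟ t ⌋ then x else + 0)
  shift i with i Fin.≟ t
  ... | yes _ = refl
  ... | no _ = refl

sumFin-support₃ : ∀ n (f : Fin n → ℤ) t₁ t₂ t₃ → t₁ ≢ t₂ → t₁ ≢ t₃ → t₂ ≢ t₃ →
                  (∀ i → i ≢ t₁ → i ≢ t₂ → i ≢ t₃ → f i ≡ + 0) →
                  sumFin n f ≡ f t₁ + f t₂ + f t₃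
sumFin-support₃ n f t₁ t₂ t₃ t₁≢t₂ t₁≢t₃ t₂≢t₃ vanish = begin
  sumFin n f                                ≡⟨ sumFin-cong n split ⟩
  sumFin n (λ i → δ t₁ i + δ t₂ i + δ t₃ i)  ≡⟨ sumFin-+ n _ _ ⟩
  sumFin n (λ i → δ t₁ i + δ t₂ i) + sumFin n (δ t₃)  ≡⟨ cong (_+ sumFin n (δ t₃)) (sumFin-+ n _ _) ⟩
  sumFin n (δ t₁) + sumFin n (δ t₂) + sumFin n (δ t₃)
    ≡⟨ cong₂ _+_ (cong₂ _+_ (sumFin-point n t₁ _) (sumFin-point n t₂ _)) (sumFin-point n t₃ _) ⟩
  f t₁ + f t₂ + f t₃                    ∎
  where
  open ≡-Reasoning
  δ : Fin n → Fin n → ℤ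
  δ t i = if ⌊ i Fin.≟ t ⌋ then f t else + 0
  split : ∀ i → f i ≡ δ t₁ i + δ t₂ i + δ t₃ i
  split i with i Fin.≟ t₁ | i Fin.≟ t₂ | i Fin.≟ t₃
  ... | yes refl | yes refl | _        = ⊥-elim (t₁≢t₂ refl)
  ... | yes refl | no _     | yes refl = ⊥-elim (t₁≢t₃ refl)
  ... | no _     | yes refl | yes refl = ⊥-elim (t₂≢t₃ refl)
  ... | yes refl | no _     | no _     = sym (trans (ℤ.+-identityʳ _) (ℤ.+-identityʳ _))
  ... | no _     | yes refl | no _     = sym (trans (ℤ.+-identityʳ _) (ℤ.+-identityˡ _))
  ... | no _     | no _     | yes refl = sym (ℤ.+-identityˡ _)
  ... | no i≢t₁  | no i≢t₂  | no i≢t₃  = vanish i i≢t₁ i≢t₂ i≢t₃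

∪⁅x⁆≡[x]≔true : ∀ (p : Subset n) x → p ∪ ⁅ x ⁆ ≡ p [ x ]≔ true
∪⁅x⁆≡[x]≔true p x = lookup-ext _ _ λ i → trans (lookup-∪ p ⁅ x ⁆ i) (pointwise i)
  where
  pointwise : ∀ i → lookup p i ∨ lookup ⁅ x ⁆ i ≡ lookup (p [ x ]≔ true) i
  pointwise i with i Fin.≟ x
  ... | yes refl rewrite Vec.[]=⇒lookup (Subset.x∈⁅x⁆ i) | Vec.lookup∘update i p true = 𝔹.∨-zeroʳ _
  ... | no i≢x with lookup ⁅ x ⁆ i in i∈⁅x⁆
  ...   | true = ⊥-elim (i≢x (Subset.x∈⁅y⁆⇒x≡y x (Vec.lookup⇒[]= i _ i∈⁅x⁆)))
  ...   | false = trans (𝔹.∨-identityʳ _) (sym (Vec.lookup∘update′ i≢x p true))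

[x]≔true-injective : ∀ (p q : Subset n) {x} → lookup p x ≡ false → lookup q x ≡ false →
                     p [ x ]≔ true ≡ q [ x ]≔ true → p ≡ q
[x]≔true-injective p q {x} x∉p x∉q eq = lookup-ext p q pointwise
  where
  pointwise : ∀ i → lookup p i ≡ lookup q i
  pointwise i with i Fin.≟ x
  ... | yes refl = trans x∉p (sym x∉q)
  ... | no i≢x = trans (sym (Vec.lookup∘update′ i≢x p true))
                   (trans (cong (λ r → lookup r i) eq) (Vec.lookup∘update′ i≢x q true))

elem-refl : ∀ k (T : Graph k) → elem k T T ≡ + 1
elem-refl k T with Vec.≡-dec 𝔹._≟_ T T
... | yes _ = refl
... | no T≢T = ⊥-elim (T≢T refl)

elem-≢ : ∀ k {T σ : Graph k} → T ≢ σ → elem k T σ ≡ + 0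
elem-≢ k {T} {σ} T≢σ with Vec.≡-dec 𝔹._≟_ T σ
... | yes T≡σ = ⊥-elim (T≢σ T≡σ)
... | no _ = refl

elem≢0⇒≡ : ∀ k {T σ : Graph k} → elem k T σ ≢ + 0 → T ≡ σ
elem≢0⇒≡ k {T} {σ} elem≢0 with Vec.≡-dec 𝔹._≟_ T σ
... | yes T≡σ = T≡σ
... | no _ = ⊥-elim (elem≢0 refl)

∂-summand : (k : ℕ) → (Graph k → ℤ) → Graph k → Fin (nE k) → ℤ
∂-summand k c σ e = if lookup σ e then + 0 else sgn ∣ σ ∩ below k e ∣ * c (σ ∪ ⁅ e ⁆)

module _ (k : ℕ) where

  ∂-+ : ∀ (c d : Graph k → ℤ) σ → ∂ k (λ τ → c τ + d τ) σ ≡ ∂ k c σ + ∂ k d σ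
  ∂-+ c d σ = trans (sumFin-cong (nE k) pointwise) (sumFin-+ (nE k) (∂-summand k c σ) (∂-summand k d σ))
    where
    pointwise : ∀ e → ∂-summand k (λ τ → c τ + d τ) σ e ≡ ∂-summand k c σ e + ∂-summand k d σ e
    pointwise e with lookup σ e
    ... | true = refl
    ... | false = ℤ.*-distribˡ-+ (sgn ∣ σ ∩ below k e ∣) _ _

  ∂-* : ∀ x (c : Graph k → ℤ) σ → ∂ k (λ τ → x * c τ) σ ≡ x * ∂ k c σ
  ∂-* x c σ = trans (sumFin-cong (nE k) pointwise) (sumFin-* (nE k) x (∂-summand k c σ))
    where
    swap : ∀ s x c → s * (x * c) ≡ x * (s * c)
    swap = solve-∀
    pointwise : ∀ e → ∂-summand k (λ τ → x * c τ) σ e ≡ x * ∂-summand k c σ e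
    pointwise e with lookup σ e
    ... | true = sym (ℤ.*-zeroʳ x)
    ... | false = swap (sgn ∣ σ ∩ below k e ∣) x (c (σ ∪ ⁅ e ⁆))

  ∂-summand-elem-≢ : ∀ {U σ : Graph k} {e} → σ ∪ ⁅ e ⁆ ≢ U → ∂-summand k (elem k U) σ e ≡ + 0
  ∂-summand-elem-≢ {U} {σ} {e} σ+e≢U with lookup σ e
  ... | true = refl
  ... | false rewrite elem-≢ k (σ+e≢U ∘ sym) = ℤ.*-zeroʳ (sgn ∣ σ ∩ below k e ∣)

  ∂-summand-elem-insert : ∀ (W : Graph k) {t} → lookup W t ≡ false →
                          ∀ σ → ∂-summand k (elem k (W [ t ]≔ true)) σ t ≡ sgn ∣ W ∩ below k t ∣ * elem k W σ
  ∂-summand-elem-insert W {t} t∉W σ with Vec.≡-dec 𝔹._≟_ W σ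
  ... | yes refl rewrite t∉W | ∪⁅x⁆≡[x]≔true W t | elem-refl k (W [ t ]≔ true) = refl
  ... | no W≢σ with lookup σ t in t∈σ
  ...   | true = sym (ℤ.*-zeroʳ (sgn ∣ W ∩ below k t ∣))
  ...   | false rewrite ∪⁅x⁆≡[x]≔true σ t
                      | elem-≢ k {W [ t ]≔ true} {σ [ t ]≔ true} (W≢σ ∘ [x]≔true-injective W σ t∉W t∈σ) =
    trans (ℤ.*-zeroʳ (sgn ∣ σ ∩ below k t ∣)) (sym (ℤ.*-zeroʳ (sgn ∣ W ∩ below k t ∣)))

  -- + 0 * x reduces to + 0.
  ∂-zero : ∀ σ → ∂ k (λ _ → + 0) σ ≡ + 0
  ∂-zero = ∂-* (+ 0) (λ _ → + 0)

  ∂-linear₃ : ∀ x u y (c : Graph k → ℤ) z (d : Graph k → ℤ) σ →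
              ∂ k (λ τ → x * (u τ + y * c τ + z * d τ)) σ ≡ x * (∂ k u σ + y * ∂ k c σ + z * ∂ k d σ)
  ∂-linear₃ x u y c z d σ = begin
    ∂ k (λ τ → x * (u τ + y * c τ + z * d τ)) σ    ≡⟨ ∂-* x (λ τ → u τ + y * c τ + z * d τ) σ ⟩
    x * ∂ k (λ τ → u τ + y * c τ + z * d τ) σ        ≡⟨ cong (x *_) (∂-+ (λ τ → u τ + y * c τ) (λ τ → z * d τ) σ) ⟩
    x * (∂ k (λ τ → u τ + y * c τ) σ + ∂ k (λ τ → z * d τ) σ)
      ≡⟨ cong₂ (λ p q → x * (p + q)) (trans (∂-+ u (λ τ → y * c τ) σ) (cong (λ q → ∂ k u σ + q) (∂-* y c σ))) (∂-* z d σ) ⟩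
    x * (∂ k u σ + y * ∂ k c σ + z * ∂ k d σ)        ∎
    where open ≡-Reasoning

sgn² : ∀ n → sgn n * sgn n ≡ + 1
sgn² zero = refl
sgn² (suc zero) = refl
sgn² (suc (suc n)) = sgn² n

HomologousToLinearTrees : (k : ℕ) → Graph k → Set
HomologousToLinearTrees k T =
  Σ (Graph k → ℤ) λ a → (∀ σ → a σ ≢ + 0 → NormedLinearTree k σ) ×
    Σ (Graph k → ℤ) λ c →
      ∀ σ → Connected k σ → ∣ σ ∣ ≡ k ∸ 1 → elem k T σ - a σ ≡ ∂ k c σ

module _ {k : ℕ} where

  linearTree-homologous : ∀ {T} → NormedLinearTree k T → HomologousToLinearTrees k T
  linearTree-homologous {T} T-linear = elem k T , supported , (λ _ → + 0) , λ σ _ _ →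
    trans (ℤ.+-inverseʳ (elem k T σ)) (sym (∂-zero k σ))
    where
    supported : ∀ σ → elem k T σ ≢ + 0 → NormedLinearTree k σ
    supported σ T≢0 = subst (NormedLinearTree k) (elem≢0⇒≡ k T≢0) T-linear

  homologous-size≢ : ∀ {T} → ∣ T ∣ ≢ k ∸ 1 → HomologousToLinearTrees k T
  homologous-size≢ {T} ∣T∣≢ = (λ _ → + 0) , (λ _ 0≢0 → ⊥-elim (0≢0 refl)) , (λ _ → + 0) , λ σ _ ∣σ∣≡ →
    trans (ℤ.+-identityʳ _) (trans (elem-≢ k {T} {σ} (∣T∣≢ ∘ λ T≡σ → trans (cong ∣_∣ T≡σ) ∣σ∣≡)) (sym (∂-zero k σ)))

  combination-supported :
    ∀ {a₁ a₂ : Graph k → ℤ} (x y z : ℤ) →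
    (∀ σ → a₁ σ ≢ + 0 → NormedLinearTree k σ) → (∀ σ → a₂ σ ≢ + 0 → NormedLinearTree k σ) →
    ∀ σ → - (x * (y * a₁ σ + z * a₂ σ)) ≢ + 0 → NormedLinearTree k σ
  combination-supported {a₁} {a₂} x y z a₁-linear a₂-linear σ a≢0 with a₁ σ ℤ.≟ + 0 | a₂ σ ℤ.≟ + 0
  ... | no a₁≢0 | _ = a₁-linear σ a₁≢0
  ... | yes _ | no a₂≢0 = a₂-linear σ a₂≢0
  ... | yes a₁≡0 | yes a₂≡0 = ⊥-elim (a≢0 (trans (cong₂ (λ u v → - (x * (y * u + z * v))) a₁≡0 a₂≡0) (vanishes x y z)))
    where
    vanishes : ∀ x y z → - (x * (y * + 0 + z * + 0)) ≡ + 0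
    vanishes = solve-∀

  homologous-by-boundary :
    ∀ {G T₁ T₂ : Graph k} (U : Graph k) (ε ε₁ ε₂ : ℤ) → ε * ε ≡ + 1 →
    (∀ σ → Connected k σ → ∣ σ ∣ ≡ k ∸ 1 → ∂ k (elem k U) σ ≡ ε * elem k G σ + ε₁ * elem k T₁ σ + ε₂ * elem k T₂ σ) →
    HomologousToLinearTrees k T₁ → HomologousToLinearTrees k T₂ → HomologousToLinearTrees k G
  homologous-by-boundary {G} {T₁} {T₂} U ε ε₁ ε₂ ε²≡1 ∂U≡
                         (a₁ , a₁-linear , c₁ , T₁≃a₁) (a₂ , a₂-linear , c₂ , T₂≃a₂) =
    a , combination-supported ε ε₁ ε₂ a₁-linear a₂-linear , c , G≃a
    where
    a c : Graph k → ℤ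
    a σ = - (ε * (ε₁ * a₁ σ + ε₂ * a₂ σ))
    c τ = ε * (elem k U τ + (- ε₁) * c₁ τ + (- ε₂) * c₂ τ)
    cancel : ∀ ε g t₁ t₂ ε₁ ε₂ a₁ a₂ →
      ε * (ε * g + ε₁ * t₁ + ε₂ * t₂ + (- ε₁) * (t₁ - a₁) + (- ε₂) * (t₂ - a₂))
      ≡ (ε * ε) * g - - (ε * (ε₁ * a₁ + ε₂ * a₂))
    cancel = solve-∀
    G≃a : ∀ σ → Connected k σ → ∣ σ ∣ ≡ k ∸ 1 → elem k G σ - a σ ≡ ∂ k c σ
    G≃a σ conn ∣σ∣≡ = sym (begin
      ∂ k c σ
        ≡⟨ ∂-linear₃ k ε (elem k U) (- ε₁) c₁ (- ε₂) c₂ σ ⟩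
      ε * (∂ k (elem k U) σ + (- ε₁) * ∂ k c₁ σ + (- ε₂) * ∂ k c₂ σ)
        ≡⟨ cong₂ (λ y z → ε * (∂ k (elem k U) σ + (- ε₁) * y + (- ε₂) * z))
                 (sym (T₁≃a₁ σ conn ∣σ∣≡)) (sym (T₂≃a₂ σ conn ∣σ∣≡)) ⟩
      ε * (∂ k (elem k U) σ + (- ε₁) * (elem k T₁ σ - a₁ σ) + (- ε₂) * (elem k T₂ σ - a₂ σ))
        ≡⟨ cong (λ x → ε * (x + (- ε₁) * (elem k T₁ σ - a₁ σ) + (- ε₂) * (elem k T₂ σ - a₂ σ))) (∂U≡ σ conn ∣σ∣≡) ⟩
      ε * (ε * elem k G σ + ε₁ * elem k T₁ σ + ε₂ * elem k T₂ σ
           + (- ε₁) * (elem k T₁ σ - a₁ σ) + (- ε₂) * (elem k T₂ σ - a₂ σ))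
        ≡⟨ cancel ε (elem k G σ) (elem k T₁ σ) (elem k T₂ σ) ε₁ ε₂ (a₁ σ) (a₂ σ) ⟩
      (ε * ε) * elem k G σ - a σ
        ≡⟨ cong (λ x → x * elem k G σ - a σ) ε²≡1 ⟩
      + 1 * elem k G σ - a σ
        ≡⟨ cong (_- a σ) (ℤ.*-identityˡ (elem k G σ)) ⟩
      elem k G σ - a σ ∎)
      where open ≡-Reasoning

fromℕ⊎inject₁ : ∀ (i : Fin (suc n)) → i ≡ Fin.fromℕ n ⊎ Σ (Fin n) λ i′ → i ≡ Fin.inject₁ i′
fromℕ⊎inject₁ {zero} Fin.zero = inj₁ refl
fromℕ⊎inject₁ {suc n} Fin.zero = inj₂ (Fin.zero , refl)
fromℕ⊎inject₁ {suc n} (Fin.suc i) with fromℕ⊎inject₁ i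
... | inj₁ refl = inj₁ refl
... | inj₂ (i′ , refl) = inj₂ (Fin.suc i′ , refl)

cycle-neighbours : ∀ {k G} (C : Cycle k G) → let open Cycle C in
                   ∀ j → Σ _ λ j₁ → Σ _ λ j₂ → j₁ ≢ j₂ × Adj k G (v j) (v j₁) × Adj k G (v j) (v j₂)
cycle-neighbours C Fin.zero = Fin.suc Fin.zero , Fin.fromℕ _ , (λ ()) , Cycle.adj C Fin.zero , adj-sym (Cycle.close C)
cycle-neighbours C (Fin.suc i) with fromℕ⊎inject₁ i
... | inj₁ refl = Fin.zero , Fin.inject₁ i , (λ ()) , Cycle.close C , adj-sym (Cycle.adj C i)
... | inj₂ (i′ , refl) = Fin.suc (Fin.suc i′) , Fin.inject₁ (Fin.inject₁ i′) , 2+i′≢i′ ,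
                         Cycle.adj C (Fin.suc i′) , adj-sym (Cycle.adj C (Fin.inject₁ i′))
  where
  2+i′≢i′ : Fin.suc (Fin.suc i′) ≢ Fin.inject₁ (Fin.inject₁ i′)
  2+i′≢i′ eq = ℕ.m≢1+n+m (toℕ i′) (sym (trans (cong toℕ eq) (trans (Fin.toℕ-inject₁ _) (Fin.toℕ-inject₁ i′))))

module NormedPaths (K : ℕ) where

  k : ℕ
  k = suc K

  -- A path from vertex 0 along which G already looks like a normed linear tree.
  record NormedPath (G : Graph k) : Set where
    field
      len              : ℕ
      vertex           : ℕ → Fin k
      edge             : ℕ → Fin (nE k)
      starts-at-0      : vertex 0 ≡ Fin.zero
      vertex-injective : ∀ {i j} → i ≤ len → j ≤ len → vertex i ≡ vertex j → i ≡ j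
      edge∈            : ∀ {i} → i < len → lookup G (edge i) ≡ true
      edge-joins       : ∀ {i} → i < len → Joins k (edge i) (vertex i) (vertex (suc i))
      start-order      : 0 < len → order k G (vertex 0) ≡ 1
      inner-order      : ∀ {i} → 0 < i → i < len → order k G (vertex i) ≡ 2

    end : Fin k
    end = vertex len

    OffPath : Fin k → Set
    OffPath x = ∀ {j} → j ≤ len → x ≢ vertex j

    NotLast : Fin (nE k) → Set
    NotLast e = ∀ {i} → suc i ≡ len → e ≢ edge i

  module _ {G : Graph k} (P : NormedPath G) where
    open NormedPath P

    len<k : len < k
    len<k = Fin.injective⇒≤ {f = vertex ∘ toℕ} λ {i} {j} eq →
      Fin.toℕ-injective (vertex-injective (ℕ.≤-pred (Fin.toℕ<n i)) (ℕ.≤-pred (Fin.toℕ<n j)) eq)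

    private
      vertex-2+i≢i : ∀ {i} → suc (suc i) ≤ len → vertex (suc (suc i)) ≢ vertex i
      vertex-2+i≢i {i} 2+i≤len eq =
        ℕ.m≢1+n+m i (sym (vertex-injective 2+i≤len (ℕ.≤-trans (ℕ.n≤1+n i) (ℕ.<⇒≤ 2+i≤len)) eq))

    -- Order 1 at the start and 2 inside leave no room for neighbours off the path.
    neighbour-on-path : ∀ {i x} → i < len → Adj k G (vertex i) x →
                        x ≡ vertex (suc i) ⊎ Σ ℕ λ i′ → suc i′ ≡ i × x ≡ vertex i′
    neighbour-on-path {i} {x} i<len (e , e∈G , j) with x Fin.≟ vertex (suc i)
    ... | yes x≡next = inj₁ x≡next
    neighbour-on-path {zero} i<len (e , e∈G , j) | no x≢next =
      ⊥-elim (ℕ.<-irrefl refl (subst (1 <_) (start-order i<len)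
        (order-≥2 {G = G} (Vec.[]=⇒lookup e∈G) j (edge∈ i<len) (edge-joins i<len) x≢next)))
    neighbour-on-path {suc i} {x} i<len (e , e∈G , j) | no x≢next with x Fin.≟ vertex i
    ... | yes x≡prev = inj₂ (i , refl , x≡prev)
    ... | no x≢prev = ⊥-elim (ℕ.<-irrefl refl (subst (2 <_) (inner-order (s≤s z≤n) i<len)
          (order-≥3 {G = G} (Vec.[]=⇒lookup e∈G) j (edge∈ i<len) (edge-joins i<len) (edge∈ i<len′) (joins-sym (edge-joins i<len′))
                    x≢next x≢prev (vertex-2+i≢i i<len))))
      where
      i<len′ = ℕ.<-trans (ℕ.n<1+n i) i<len

    off-path : ∀ {e x} → lookup G e ≡ true → Joins k e end x → NotLast e → OffPath x
    off-path {e} {x} e∈G j not-last {i} i≤len refl with ℕ.m≤n⇒m<n∨m≡n i≤len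
    ... | inj₂ refl = joins-irrefl j refl
    ... | inj₁ i<len with neighbour-on-path i<len (e , Vec.lookup⇒[]= e G e∈G , joins-sym j)
    ...   | inj₁ end≡next with vertex-injective ℕ.≤-refl i<len end≡next
    ...     | refl = not-last refl (joins-unique j (joins-sym (edge-joins i<len)))
    off-path {e} {x} e∈G j not-last {i} i≤len refl | inj₁ i<len | inj₂ (i′ , refl , end≡prev) =
      ℕ.<-irrefl (sym (vertex-injective ℕ.≤-refl (ℕ.<⇒≤ (ℕ.<-trans (ℕ.n<1+n i′) i<len)) end≡prev))
                 (ℕ.<-trans (ℕ.n<1+n i′) i<len)

    module _ {l : ℕ} (l+1≡len : suc l ≡ len) (end-leaf : order k G end ≡ 1) where

      private
        l<len : l < len
        l<len = subst (l <_) l+1≡len ℕ.≤-refl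

      end-neighbour : ∀ {x} → Adj k G end x → x ≡ vertex l
      end-neighbour {x} (e , e∈G , j) with x Fin.≟ vertex l
      ... | yes x≡prev = x≡prev
      ... | no x≢prev = ⊥-elim (ℕ.<-irrefl refl (subst (1 <_) end-leaf
            (order-≥2 {G = G} (Vec.[]=⇒lookup e∈G) j (edge∈ l<len)
                      (subst (λ v → Joins k (edge l) v (vertex l)) (cong vertex l+1≡len) (joins-sym (edge-joins l<len)))
                      x≢prev)))

      neighbour-on-path≤ : ∀ {i x} → i ≤ len → Adj k G (vertex i) x →
                           (suc i ≤ len × x ≡ vertex (suc i)) ⊎ Σ ℕ λ i′ → suc i′ ≡ i × x ≡ vertex i′
      neighbour-on-path≤ i≤len ix with ℕ.m≤n⇒m<n∨m≡n i≤len
      ... | inj₁ i<len = map₁ (i<len ,_) (neighbour-on-path i<len ix)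
      ... | inj₂ refl = inj₂ (l , l+1≡len , end-neighbour ix)

      on-path : Connected k G → ∀ y → Σ ℕ λ i → i ≤ len × y ≡ vertex i
      on-path conn y = reach-on-path (subst (λ v → Reach k G v y) (sym starts-at-0) (conn Fin.zero y))
        where
        reach-on-path : ∀ {y} → Reach k G (vertex 0) y → Σ ℕ λ i → i ≤ len × y ≡ vertex i
        reach-on-path here = 0 , z≤n , refl
        reach-on-path (step r xy) with reach-on-path r
        ... | i , i≤len , refl with neighbour-on-path≤ i≤len xy
        ...   | inj₁ (i<len , y≡next) = suc i , i<len , y≡next
        ...   | inj₂ (i′ , refl , y≡prev) = i′ , ℕ.<⇒≤ i≤len , y≡prev

      -- A cycle through vertex i would have two distinct neighbours there, so one of them is
      -- vertex (i − 1); descending, vertex 0 would need two.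
      acyclic : Connected k G → Acyclic k G
      acyclic conn C with i , i≤len , v₀≡ ← on-path conn (Cycle.v C Fin.zero) = off-cycle i≤len Fin.zero v₀≡
        where
        off-cycle : ∀ {i} → i ≤ len → ∀ j → Cycle.v C j ≢ vertex i
        off-cycle {i} i≤len j vⱼ≡ with j₁ , j₂ , j₁≢j₂ , a₁ , a₂ ← cycle-neighbours C j
          with neighbour-on-path≤ i≤len (subst (λ v → Adj k G v _) vⱼ≡ a₁)
             | neighbour-on-path≤ i≤len (subst (λ v → Adj k G v _) vⱼ≡ a₂)
        ... | inj₁ (_ , v₁≡) | inj₁ (_ , v₂≡) = j₁≢j₂ (Cycle.inj C (trans v₁≡ (sym v₂≡)))
        ... | inj₂ (i′ , refl , v₁≡) | _ = off-cycle (ℕ.<⇒≤ i≤len) j₁ v₁≡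
        ... | inj₁ _ | inj₂ (i′ , refl , v₂≡) = off-cycle (ℕ.<⇒≤ i≤len) j₂ v₂≡

      order≤2 : Connected k G → ∀ y → order k G y ≤ 2
      order≤2 conn y with on-path conn y
      ... | zero , _ , refl = ℕ.≤-trans (ℕ.≤-reflexive (start-order (subst (0 <_) l+1≡len (s≤s z≤n)))) (s≤s z≤n)
      ... | suc i , i+1≤len , refl with ℕ.m≤n⇒m<n∨m≡n i+1≤len
      ...   | inj₁ i+1<len = ℕ.≤-reflexive (inner-order (s≤s z≤n) i+1<len)
      ...   | inj₂ refl = ℕ.≤-trans (ℕ.≤-reflexive end-leaf) (s≤s z≤n)

      normedLinearTree : Connected k G → NormedLinearTree k G
      normedLinearTree conn = ((conn , acyclic conn) , root-leaf) , order≤2 conn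
        where
        root-leaf : ∀ v → toℕ v ≡ 0 → order k G v ≡ 1
        root-leaf Fin.zero _ = subst (λ v → order k G v ≡ 1) starts-at-0 (start-order (subst (0 <_) l+1≡len (s≤s z≤n)))

    module Extension {e x} (e∈G : lookup G e ≡ true) (j : Joins k e end x) (x-off : OffPath x)
                     (start-leaf : len ≡ 0 → order k G (vertex 0) ≡ 1) (end-inner : 0 < len → order k G end ≡ 2) where

      private
        vertex′ : ℕ → Fin k
        vertex′ i with i ℕ.≤? len
        ... | yes _ = vertex i
        ... | no _ = x

        vertex′-≤ : ∀ {i} → i ≤ len → vertex′ i ≡ vertex i
        vertex′-≤ {i} i≤len with i ℕ.≤? len
        ... | yes _ = refl
        ... | no i≰len = ⊥-elim (i≰len i≤len)

        vertex′-new : vertex′ (suc len) ≡ x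
        vertex′-new with suc len ℕ.≤? len
        ... | yes len<len = ⊥-elim (ℕ.<-irrefl refl len<len)
        ... | no _ = refl

        edge′ : ℕ → Fin (nE k)
        edge′ i with i ℕ.≟ len
        ... | yes _ = e
        ... | no _ = edge i

        edge′-< : ∀ {i} → i < len → edge′ i ≡ edge i
        edge′-< {i} i<len with i ℕ.≟ len
        ... | yes refl = ⊥-elim (ℕ.<-irrefl refl i<len)
        ... | no _ = refl

        edge′-new : edge′ len ≡ e
        edge′-new with len ℕ.≟ len
        ... | yes _ = refl
        ... | no len≢len = ⊥-elim (len≢len refl)

        old⊎new : ∀ {i} → i < suc len → i < len ⊎ i ≡ len
        old⊎new i<1+len = ℕ.m≤n⇒m<n∨m≡n (ℕ.≤-pred i<1+len)

        injective′ : ∀ {i j} → i ≤ suc len → j ≤ suc len → vertex′ i ≡ vertex′ j → i ≡ j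
        injective′ {i} {j} i≤ j≤ eq with ℕ.m≤n⇒m<n∨m≡n i≤ | ℕ.m≤n⇒m<n∨m≡n j≤
        ... | inj₁ (s≤s i≤len) | inj₁ (s≤s j≤len) =
          vertex-injective i≤len j≤len (trans (sym (vertex′-≤ i≤len)) (trans eq (vertex′-≤ j≤len)))
        ... | inj₁ (s≤s i≤len) | inj₂ refl = ⊥-elim (x-off i≤len (trans (sym vertex′-new) (trans (sym eq) (vertex′-≤ i≤len))))
        ... | inj₂ refl | inj₁ (s≤s j≤len) = ⊥-elim (x-off j≤len (trans (sym vertex′-new) (trans eq (vertex′-≤ j≤len))))
        ... | inj₂ refl | inj₂ refl = refl

        edge∈′ : ∀ {i} → i < suc len → lookup G (edge′ i) ≡ true
        edge∈′ i< with old⊎new i<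
        ... | inj₁ i<len = trans (cong (lookup G) (edge′-< i<len)) (edge∈ i<len)
        ... | inj₂ refl = trans (cong (lookup G) edge′-new) e∈G

        edge-joins′ : ∀ {i} → i < suc len → Joins k (edge′ i) (vertex′ i) (vertex′ (suc i))
        edge-joins′ i< with old⊎new i<
        ... | inj₁ i<len rewrite edge′-< i<len | vertex′-≤ (ℕ.<⇒≤ i<len) | vertex′-≤ i<len = edge-joins i<len
        ... | inj₂ refl rewrite edge′-new | vertex′-≤ (ℕ.≤-refl {len}) | vertex′-new = j

        start-order′ : 0 < suc len → order k G (vertex′ 0) ≡ 1
        start-order′ _ rewrite vertex′-≤ {0} z≤n with len ℕ.≟ 0
        ... | yes len≡0 = start-leaf len≡0
        ... | no len≢0 = start-order (ℕ.n≢0⇒n>0 len≢0)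

        inner-order′ : ∀ {i} → 0 < i → i < suc len → order k G (vertex′ i) ≡ 2
        inner-order′ i>0 i< with old⊎new i<
        ... | inj₁ i<len rewrite vertex′-≤ (ℕ.<⇒≤ i<len) = inner-order i>0 i<len
        ... | inj₂ refl rewrite vertex′-≤ (ℕ.≤-refl {len}) = end-inner i>0

      path : NormedPath G
      path = record
        { len = suc len ; vertex = vertex′ ; edge = edge′
        ; starts-at-0 = trans (vertex′-≤ z≤n) starts-at-0
        ; vertex-injective = injective′ ; edge∈ = edge∈′ ; edge-joins = edge-joins′
        ; start-order = start-order′ ; inner-order = inner-order′ }

  record Fork {G : Graph k} (P : NormedPath G) : Set where
    open NormedPath P
    field
      {e₁ e₂}    : Fin (nE k)
      {c₁ c₂}    : Fin k
      e₁∈        : lookup G e₁ ≡ true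
      e₂∈        : lookup G e₂ ≡ true
      e₁-joins   : Joins k e₁ end c₁
      e₂-joins   : Joins k e₂ end c₂
      c₁≢c₂      : c₁ ≢ c₂
      c₁-off     : OffPath c₁
      c₂-off     : OffPath c₂

  module Branch {G : Graph k} (conn : Connected k G) (∣G∣≡ : ∣ G ∣ ≡ k ∸ 1) {P : NormedPath G} (F : Fork P) where
    open NormedPath P
    open Fork F

    f : Fin (nE k)
    f = proj₁ (edgeJoining c₁≢c₂)

    f-joins : Joins k f c₁ c₂
    f-joins = proj₂ (edgeJoining c₁≢c₂)

    f∉G : lookup G f ≡ false
    f∉G with lookup G f in f∈G
    ... | true = ⊥-elim (connected-¬triangle conn ∣G∣≡ e₁∈ f∈G e₂∈ e₁-joins f-joins e₂-joins)
    ... | false = refl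

    U : Graph k
    U = G [ f ]≔ true

    ∈G⇒≢f : ∀ {e} → lookup G e ≡ true → e ≢ f
    ∈G⇒≢f e∈G refl = true≢false (trans (sym e∈G) f∉G)

    G⊆U : G ⊆ᵇ U
    G⊆U e e∈G = trans (Vec.lookup∘update′ (∈G⇒≢f e∈G) G true) e∈G

    module Cut {ea eb ca cb} (ea∈ : lookup G ea ≡ true) (eb∈ : lookup G eb ≡ true)
               (ea-joins : Joins k ea end ca) (eb-joins : Joins k eb end cb) (f-joins′ : Joins k f ca cb)
               (ca-off : OffPath ca) (cb-off : OffPath cb) where

      T : Graph k
      T = U [ ea ]≔ false

      ea∉T : lookup T ea ≡ false
      ea∉T = Vec.lookup∘update ea U false

      ea∈U : lookup U ea ≡ true
      ea∈U = G⊆U ea ea∈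

      T-G : ∀ {e} → e ≢ ea → e ≢ f → lookup T e ≡ lookup G e
      T-G e≢ea e≢f = trans (Vec.lookup∘update′ e≢ea U false) (Vec.lookup∘update′ e≢f G true)

      U≡T+ea : U ≡ T [ ea ]≔ true
      U≡T+ea = sym (trans (Vec.[]≔-idempotent U ea) (trans (cong (U [ ea ]≔_) (sym ea∈U)) (Vec.[]≔-lookup U ea)))

      ea≢eb : ea ≢ eb
      ea≢eb refl with joins-ends ea-joins eb-joins
      ... | inj₁ (_ , ca≡cb) = joins-irrefl f-joins′ ca≡cb
      ... | inj₂ (_ , ca≡end) = joins-irrefl ea-joins (sym ca≡end)

      ∣T∣≡ : ∣ T ∣ ≡ k ∸ 1
      ∣T∣≡ = ℕ.suc-injective (trans (sym (∣p∣≡1+∣p-x∣ U ea ea∈U)) (trans (∣p+x∣≡1+∣p∣ G f f∉G) (cong suc ∣G∣≡)))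

      T-connected : Connected k T
      T-connected = connected-minus-triangle-edge U-connected (Vec.lookup∘update f G true) (G⊆U eb eb∈)
                      ea-joins f-joins′ eb-joins
        where
        U-connected : Connected k U
        U-connected = connected-mono (λ { (e , e∈G , j) → adj⇒reach (e , Vec.lookup⇒[]= e U (G⊆U e (Vec.[]=⇒lookup e∈G)) , j) }) conn

      private
        inner-edge-kept : ∀ {i e y} → i < len → Joins k e (vertex i) y → e ≢ ea × e ≢ f
        inner-edge-kept {i} i<len j = ≢ea , ≢f
          where
          ≢ea : _
          ≢ea refl with joins-ends j ea-joins
          ... | inj₁ (vᵢ≡end , _) = ℕ.<-irrefl (vertex-injective (ℕ.<⇒≤ i<len) ℕ.≤-refl vᵢ≡end) i<len
          ... | inj₂ (vᵢ≡ca , _) = ca-off (ℕ.<⇒≤ i<len) (sym vᵢ≡ca)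
          ≢f : _
          ≢f refl with joins-ends j f-joins′
          ... | inj₁ (vᵢ≡ca , _) = ca-off (ℕ.<⇒≤ i<len) (sym vᵢ≡ca)
          ... | inj₂ (vᵢ≡cb , _) = cb-off (ℕ.<⇒≤ i<len) (sym vᵢ≡cb)

        order-kept : ∀ {i} → i < len → order k T (vertex i) ≡ order k G (vertex i)
        order-kept {i} i<len = order-cong T G (vertex i) λ e e∈vᵢ →
          let ≢ea , ≢f = inner-edge-kept i<len (proj₂ (incident⇒joins e∈vᵢ)) in T-G ≢ea ≢f

      T-path : Σ (NormedPath T) λ P′ → NormedPath.len P′ ≡ len × NormedPath.end P′ ≡ end
      T-path = record
        { len = len ; vertex = vertex ; edge = edge
        ; starts-at-0 = starts-at-0 ; vertex-injective = vertex-injective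
        ; edge∈ = λ i<len → let ≢ea , ≢f = inner-edge-kept i<len (edge-joins i<len) in trans (T-G ≢ea ≢f) (edge∈ i<len)
        ; edge-joins = edge-joins
        ; start-order = λ len>0 → trans (order-kept len>0) (start-order len>0)
        ; inner-order = λ i>0 i<len → trans (order-kept i<len) (inner-order i>0 i<len)
        } , refl , refl

      end-order-drops : order k G end ≡ suc (order k T end)
      end-order-drops = trans (∣p∣≡1+∣p-x∣ (G ∩ incident k end) ea (∈incidence {G = G} ea∈ ea-joins))
                              (cong suc (cong ∣_∣ (lookup-ext ((G ∩ incident k end) [ ea ]≔ false) (T ∩ incident k end) pointwise)))
        where
        pointwise : ∀ e → lookup ((G ∩ incident k end) [ ea ]≔ false) e ≡ lookup (T ∩ incident k end) e
        pointwise e rewrite lookup-∩ T (incident k end) e with e Fin.≟ ea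
        ... | yes refl rewrite Vec.lookup∘update ea (G ∩ incident k end) false | ea∉T = refl
        ... | no e≢ea rewrite Vec.lookup∘update′ e≢ea (G ∩ incident k end) false | lookup-∩ G (incident k end) e with e Fin.≟ f
        ...   | no e≢f rewrite T-G e≢ea e≢f = refl
        ...   | yes refl rewrite f∉G
                     | incident-¬joins f-joins′ (λ end≡ca → ca-off ℕ.≤-refl (sym end≡ca)) (λ end≡cb → cb-off ℕ.≤-refl (sym end≡cb)) =
          sym (𝔹.∧-zeroʳ _)

      ∂U-summand : ∀ σ → ∂-summand k (elem k U) σ ea ≡ sgn ∣ T ∩ below k ea ∣ * elem k T σ
      ∂U-summand σ = subst (λ W → ∂-summand k (elem k W) σ ea ≡ sgn ∣ T ∩ below k ea ∣ * elem k T σ)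
                        (sym U≡T+ea) (∂-summand-elem-insert k T ea∉T σ)

    module Cut₁ = Cut e₁∈ e₂∈ e₁-joins e₂-joins f-joins c₁-off c₂-off
    module Cut₂ = Cut e₂∈ e₁∈ e₂-joins e₁-joins (joins-sym f-joins) c₂-off c₁-off

    ∂U≡ : ∀ σ → Connected k σ → ∣ σ ∣ ≡ k ∸ 1 →
          ∂ k (elem k U) σ ≡ sgn ∣ G ∩ below k f ∣ * elem k G σ + sgn ∣ Cut₁.T ∩ below k e₁ ∣ * elem k Cut₁.T σ
                                                               + sgn ∣ Cut₂.T ∩ below k e₂ ∣ * elem k Cut₂.T σ
    ∂U≡ σ σ-conn ∣σ∣≡ =
      trans (sumFin-support₃ (nE k) (∂-summand k (elem k U) σ) f e₁ e₂
                             (∈G⇒≢f e₁∈ ∘ sym) (∈G⇒≢f e₂∈ ∘ sym) Cut₁.ea≢eb other)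
            (cong₂ _+_ (cong₂ _+_ (∂-summand-elem-insert k G f∉G σ) (Cut₁.∂U-summand σ)) (Cut₂.∂U-summand σ))
      where
      other : ∀ e → e ≢ f → e ≢ e₁ → e ≢ e₂ → ∂-summand k (elem k U) σ e ≡ + 0
      other e e≢f e≢e₁ e≢e₂ = ∂-summand-elem-≢ k λ σ+e≡U →
        let in-σ : ∀ {t} → t ≢ e → lookup U t ≡ true → lookup σ t ≡ true
            in-σ {t} t≢e t∈U = trans (sym (Vec.lookup∘update′ t≢e σ true))
                                 (trans (cong (λ W → lookup W t) (trans (sym (∪⁅x⁆≡[x]≔true σ e)) σ+e≡U)) t∈U)
        in connected-¬triangle σ-conn ∣σ∣≡ (in-σ (e≢e₁ ∘ sym) Cut₁.ea∈U) (in-σ (e≢f ∘ sym) (Vec.lookup∘update f G true))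
                               (in-σ (e≢e₂ ∘ sym) Cut₂.ea∈U) e₁-joins f-joins e₂-joins

    homologous : HomologousToLinearTrees k Cut₁.T → HomologousToLinearTrees k Cut₂.T → HomologousToLinearTrees k G
    homologous = homologous-by-boundary U (sgn ∣ G ∩ below k f ∣) (sgn ∣ Cut₁.T ∩ below k e₁ ∣) (sgn ∣ Cut₂.T ∩ below k e₂ ∣)
                                        (sgn² ∣ G ∩ below k f ∣) ∂U≡

  data Step {G : Graph k} (P : NormedPath G) : Set where
    done   : NormedLinearTree k G → Step P
    longer : (P′ : NormedPath G) → NormedPath.len P′ ≡ suc (NormedPath.len P) → Step P
    fork   : Fork P → Step P

  module _ {G : Graph k} (conn : Connected k G) (P : NormedPath G) where
    open NormedPath P

    private
      fork-of : ∀ {e₁ e₂} → lookup (G ∩ incident k end) e₁ ≡ true → lookup (G ∩ incident k end) e₂ ≡ true →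
                e₂ ≢ e₁ → NotLast e₁ → NotLast e₂ → Step P
      fork-of e₁∈ e₂∈ e₂≢e₁ e₁-new e₂-new
        with e₁∈G , c₁ , j₁ ← ∈incidence⁻ {G = G} e₁∈ | e₂∈G , c₂ , j₂ ← ∈incidence⁻ {G = G} e₂∈ =
        fork record
          { e₁∈ = e₁∈G ; e₂∈ = e₂∈G ; e₁-joins = j₁ ; e₂-joins = j₂
          ; c₁≢c₂ = λ { refl → e₂≢e₁ (joins-unique j₂ j₁) }
          ; c₁-off = off-path P e₁∈G j₁ e₁-new ; c₂-off = off-path P e₂∈G j₂ e₂-new }

      longer-of : ∀ {e} → lookup (G ∩ incident k end) e ≡ true → NotLast e →
                  (len ≡ 0 → order k G (vertex 0) ≡ 1) → (0 < len → order k G end ≡ 2) → Step P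
      longer-of e∈ e-new start-leaf end-inner with e∈G , x , j ← ∈incidence⁻ {G = G} e∈ =
        longer (Extension.path P e∈G j (off-path P e∈G j e-new) start-leaf end-inner) refl

      no-last-edge : len ≡ 0 → ∀ {e} → NotLast e
      no-last-edge len≡0 1+i≡len _ = ℕ.1+n≢0 (trans 1+i≡len len≡0)

      step-at-start : len ≡ 0 → (w : Fin k) → w ≢ Fin.zero → Step P
      step-at-start len≡0 w w≢0 with order k G end in d≡
      ... | zero with _ , e , e∈G , j ← first-edge (conn end w) (λ end≡w → w≢0 (trans (sym end≡w) (trans (cong vertex len≡0) starts-at-0)))
        = ⊥-elim (ℕ.<-irrefl refl (subst (0 <_) d≡ (∣p∣≥1 (G ∩ incident k end) (∈incidence {G = G} (Vec.[]=⇒lookup e∈G) j))))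
      ... | suc zero with e , e∈ ← ∣p∣>0⇒member (G ∩ incident k end) (ℕ.≤-reflexive (sym d≡)) =
        longer-of e∈ (no-last-edge len≡0)
                  (λ len≡0 → subst (λ i → order k G (vertex i) ≡ 1) len≡0 d≡) (λ len>0 → ⊥-elim (ℕ.<-irrefl (sym len≡0) len>0))
      ... | suc (suc d) with e₁ , e₁∈ ← ∣p∣>0⇒member (G ∩ incident k end) (subst (0 <_) (sym d≡) (s≤s z≤n))
                        with e₂ , e₂∈ , e₂≢e₁ ← member≢ (G ∩ incident k end) e₁∈ (subst (2 ≤_) (sym d≡) (s≤s (s≤s z≤n))) =
        fork-of e₁∈ e₂∈ e₂≢e₁ (no-last-edge len≡0) (no-last-edge len≡0)

    module _ {l} (l+1≡len : suc l ≡ len) where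

      private
        last∈ : lookup (G ∩ incident k end) (edge l) ≡ true
        last∈ = ∈incidence {G = G} (edge∈ l<len)
                  (subst (λ v → Joins k (edge l) v (vertex l)) (cong vertex l+1≡len) (joins-sym (edge-joins l<len)))
          where l<len = subst (l <_) l+1≡len ℕ.≤-refl

        not-last : ∀ {e} → e ≢ edge l → NotLast e
        not-last e≢last i+1≡len refl = e≢last (cong edge (ℕ.suc-injective (trans i+1≡len (sym l+1≡len))))

      step-inside : Step P
      step-inside with order k G end in d≡
      ... | zero = ⊥-elim (ℕ.<-irrefl refl (subst (0 <_) d≡ (∣p∣≥1 (G ∩ incident k end) last∈)))
      ... | suc zero = done (normedLinearTree P l+1≡len d≡ conn)
      ... | suc (suc zero) with e , e∈ , e≢last ← member≢ (G ∩ incident k end) last∈ (ℕ.≤-reflexive (sym d≡)) =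
        longer-of e∈ (not-last e≢last) (λ len≡0 → ⊥-elim (ℕ.1+n≢0 (trans l+1≡len len≡0))) (λ _ → d≡)
      ... | suc (suc (suc d))
        with e₁ , e₁∈ , e₁≢last ← member≢ (G ∩ incident k end) last∈ (subst (2 ≤_) (sym d≡) (s≤s (s≤s z≤n)))
        with e₂ , e₂∈ , e₂≢last , e₂≢e₁ ← member≢≢ (G ∩ incident k end) last∈ e₁∈ e₁≢last
                                             (subst (3 ≤_) (sym d≡) (s≤s (s≤s (s≤s z≤n)))) =
        fork-of e₁∈ e₂∈ e₂≢e₁ (not-last e₁≢last) (not-last e₂≢last)

    nextStep : (w : Fin k) → w ≢ Fin.zero → Step P
    nextStep w w≢0 with len in len≡
    ... | zero = step-at-start len≡ w w≢0
    ... | suc l = step-inside (sym len≡)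

module Reduction (K : ℕ) where
  open NormedPaths (suc K)

  emptyPath : ∀ {G} → NormedPath G
  emptyPath = record
    { len = 0 ; vertex = λ _ → Fin.zero ; edge = λ _ → proj₁ (edgeJoining {k = k} {a = Fin.zero} {Fin.suc Fin.zero} λ ())
    ; starts-at-0 = refl ; vertex-injective = λ { z≤n z≤n _ → refl }
    ; edge∈ = λ () ; edge-joins = λ () ; start-order = λ () ; inner-order = λ _ () }

  Claim : ℕ → ℕ → Set
  Claim a d = ∀ {G} → Connected k G → ∣ G ∣ ≡ k ∸ 1 → (P : NormedPath G) →
              k ∸ NormedPath.len P ≡ a → order k G (NormedPath.end P) ≡ d → HomologousToLinearTrees k G

  claim : ∀ a d → Claim a d
  claim = <-rec _ λ a outer → <-rec _ λ d inner → claim-step outer inner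
    where
    claim-step : ∀ {a d} → (∀ {a′} → a′ < a → ∀ d′ → Claim a′ d′) → (∀ {d′} → d′ < d → Claim a d′) → Claim a d
    claim-step outer inner {G} conn ∣G∣≡ P refl refl with nextStep conn P (Fin.suc Fin.zero) (λ ())
    ... | done G-linear = linearTree-homologous G-linear
    ... | longer P′ len≡ = outer (subst (λ l → k ∸ l < k ∸ NormedPath.len P) (sym len≡)
                                        (ℕ.∸-monoʳ-< ℕ.≤-refl (len<k P))) _ conn ∣G∣≡ P′ refl refl
    ... | fork F = Branch.homologous conn ∣G∣≡ F (cut-homologous Cut₁.T-path Cut₁.T-connected Cut₁.∣T∣≡ Cut₁.end-order-drops)
                                                  (cut-homologous Cut₂.T-path Cut₂.T-connected Cut₂.∣T∣≡ Cut₂.end-order-drops)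
      where
      open Branch conn ∣G∣≡ F
      cut-homologous : ∀ {T} → Σ (NormedPath T) (λ P′ → NormedPath.len P′ ≡ NormedPath.len P × NormedPath.end P′ ≡ NormedPath.end P) →
            Connected k T → ∣ T ∣ ≡ k ∸ 1 → order k G (NormedPath.end P) ≡ suc (order k T (NormedPath.end P)) →
            HomologousToLinearTrees k T
      cut-homologous {T} (P′ , len≡ , end≡) T-conn ∣T∣≡ drop =
        inner (subst (λ v → order k T v < _) (sym end≡) (ℕ.≤-reflexive (sym drop))) T-conn ∣T∣≡ P′ (cong (k ∸_) len≡) refl

lemma5 : (k : ℕ) → 2 ≤ k → (T : Graph k) → NormedTree k T →
    Σ (Graph k → ℤ) λ a → (∀ σ → a σ ≢ + 0 → NormedLinearTree k σ) ×
      Σ (Graph k → ℤ) λ c →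
        ∀ σ → Connected k σ → ∣ σ ∣ ≡ k ∸ 1 → elem k T σ - a σ ≡ ∂ k c σ
lemma5 (suc (suc K)) (s≤s (s≤s z≤n)) T ((T-connected , _) , _) with ∣ T ∣ ℕ.≟ suc K
... | yes ∣T∣≡ = Reduction.claim K _ _ T-connected ∣T∣≡ (Reduction.emptyPath K) refl refl
... | no ∣T∣≢ = homologous-size≢ {T = T} ∣T∣≢
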